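{- Let $q$ be a prime power and let $\ell, m, m_1, m_2 \geq 0$ be integers with $\ell \leq m = m_1 + m_2$. Let $\bm{A}$ be uniformly random in $\mathbb{F}_q^{\ell \times m, \ell}$ and write $\bm{A} = (\bm{A}_1 \mid \bm{A}_2)$ where $\bm{A}_1 \in \mathbb{F}_q^{\ell \times m_1}$ and $\bm{A}_2 \in \mathbb{F}_q^{\ell \times m_2}$. Then for every integer $r$ with $0 \leq r \leq \min(\ell, m_1)$, \[ \mathbb{P}\big[\operatorname{rank}(\bm{A}_1) = r\big] = \frac{|\mathbb{F}_q^{\ell \times m_1, r}| \, |\mathbb{F}_q^{(\ell-r) \times m_2, \ell - r}| \, q^{m_2 r}}{|\mathbb{F}_q^{\ell \times m, \ell}|}. \]
   Context: $\mathbb{F}_q$ is the finite field with $q$ elements. For integers $a,b,r\ge0$, $\mathbb{F}_q^{a \times b, r}$ denotes the set of $a\times b$ matrices over $\mathbb{F}_q$ of rank exactly $r$ (matrices with zero rows or columns are allowed, having rank $0$). -}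

module Defs where

open import Level using (0ℓ)
open import Data.Nat using (ℕ; zero; suc; _^_)
open import Data.Nat.Primality using (Prime)
open import Data.Fin using (Fin; _↑ˡ_)
import Data.Fin as Fin
import Data.Nat
open import Data.Product using (Σ; ∃; _×_; _,_)
open import Relation.Binary.PropositionalEquality using (_≡_; _≢_)
open import Relation.Nullary using (¬_)
open import Function.Bundles using (_↔_)
open import Algebra.Structures using (IsCommutativeRing)

IsPrimePower : ℕ → Set
IsPrimePower q = Σ ℕ λ p → Σ ℕ λ k → Prime p × q ≡ p ^ suc k

record Field : Set₁ where
  infixl 6 _+_
  infixl 7 _*_
  field
    Carrier : Set
    _+_ _*_ : Carrier → Carrier → Carrier
    -_      : Carrier → Carrier
    0# 1#   : Carrier
    isCommutativeRing : IsCommutativeRing _≡_ _+_ _*_ -_ 0# 1#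
    0≢1     : 0# ≢ 1#
    inverse : ∀ x → x ≢ 0# → ∃ λ y → x * y ≡ 1#

HasSize : Field → ℕ → Set
HasSize F q = Field.Carrier F ↔ Fin q

-- Cardinality of a type A up to an equivalence _≈_ (here: pointwise equality
-- of matrices): A/≈ is in bijection with Fin n.
record HasCard (A : Set) (_≈_ : A → A → Set) (n : ℕ) : Set where
  field
    to      : A → Fin n
    from    : Fin n → A
    to-cong : ∀ x y → x ≈ y → to x ≡ to y
    from-to : ∀ x → from (to x) ≈ x
    to-from : ∀ i → to (from i) ≡ i

module _ (F : Field) where
  open Field F

  Mat : ℕ → ℕ → Set
  Mat a b = Fin a → Fin b → Carrier

  _≈M_ : ∀ {a b} → Mat a b → Mat a b → Set
  A ≈M B = ∀ i j → A i j ≡ B i j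

  sumF : ∀ {k} → (Fin k → Carrier) → Carrier
  sumF {zero}  f = 0#
  sumF {suc k} f = f Fin.zero + sumF (λ i → f (Fin.suc i))

  LinIndep : ∀ {k b} → (Fin k → Fin b → Carrier) → Set
  LinIndep {k} {b} v =
    (c : Fin k → Carrier) → (∀ j → sumF (λ i → c i * v i j) ≡ 0#) → ∀ i → c i ≡ 0#

  HasRank : ∀ {a b} → Mat a b → ℕ → Set
  HasRank {a} A r =
    (Σ (Fin r → Fin a) λ σ → LinIndep (λ i → A (σ i))) ×
    ((σ : Fin (suc r) → Fin a) → ¬ LinIndep (λ i → A (σ i)))

  RankMat : ℕ → ℕ → ℕ → Set
  RankMat a b r = Σ (Mat a b) λ A → HasRank A r

  _≈R_ : ∀ {a b r} → RankMat a b r → RankMat a b r → Set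
  (A , _) ≈R (B , _) = A ≈M B

  leftBlock : ∀ {l} m₁ m₂ → Mat l (m₁ Data.Nat.+ m₂) → Mat l m₁
  leftBlock m₁ m₂ A i j = A i (j ↑ˡ m₂)

  Event : ℕ → ℕ → ℕ → ℕ → Set
  Event l m₁ m₂ r = Σ (RankMat l (m₁ Data.Nat.+ m₂) l) λ { (A , _) → HasRank (leftBlock m₁ m₂ A) r }

  _≈E_ : ∀ {l m₁ m₂ r} → Event l m₁ m₂ r → Event l m₁ m₂ r → Set
  ((A , _) , _) ≈E ((B , _) , _) = A ≈M B

{-# OPTIONS --safe #-}
-- Fix the left block A₁ of rank r, choose r independent rows σ of it and let μ express the other
-- s = l - r rows τ of A₁ through them.  Subtracting from the rows τ of A = (A₁ ∣ A₂) the same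
-- combinations μ of the rows σ is an invertible row operation; it makes A block triangular, with
-- diagonal blocks A₁ ∘ σ (independent) and the residual D = A₂ ∘ τ - μ (A₂ ∘ σ).  Hence A has full
-- row rank iff D has, and A₂ ↦ (A₂ ∘ σ , D) is a bijection from the full-rank completions of A₁
-- onto F^(r × m₂) × F^(s × m₂, s).  Summing over A₁ gives N = N₁ q^(m₂ r) N₂.

module Submission where

open import Defs
open import Data.Nat using (ℕ; _+_; _*_; _^_; _∸_; _≤_)
open import Relation.Binary.PropositionalEquality using (_≡_)

open import Level using (0ℓ)
open import Data.Nat using (zero; suc)
import Data.Nat.Properties as ℕ
open import Data.Fin as Fin using (Fin; zero; suc; _↑ˡ_; _↑ʳ_; combine; remQuot; punchOut)
import Data.Fin.Properties as Fin
open import Data.Fin.Permutation as Perm using (Permutation; _⟨$⟩ʳ_; _⟨$⟩ˡ_; permutation; _∘ₚ_)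
open import Data.Vec.Functional using (_∷_; _++_; head; tail)
open import Data.Vec.Functional.Properties using (lookup-++ˡ; lookup-++ʳ)
import Data.Vec.Functional.Relation.Binary.Pointwise as Vector
import Data.Vec.Functional.Relation.Binary.Pointwise.Properties as Vector
import Data.Product.Relation.Binary.Pointwise.NonDependent as Product
open import Data.Product using (Σ; ∃; _×_; _,_; proj₁; proj₂; uncurry)
open import Data.Empty using (⊥-elim)
open import Function using (_∘_; id)
open import Function.Bundles using (_⇔_; mk⇔; Equivalence; Inverse)
open import Function.Definitions using (Injective)
open import Function.Properties.Equivalence using (⇔-setoid)
open import Function.Properties.Inverse using (↔⇒↣)
open import Relation.Binary.Core using (Rel)
open import Relation.Binary.Definitions using (Reflexive; Transitive; DecidableEquality)
open import Relation.Binary.PropositionalEquality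
  using (_≢_; _≗_; refl; sym; trans; cong; cong₂; cong-app; subst; module ≡-Reasoning)
open import Relation.Nullary using (¬_; Dec; yes; no)
open import Relation.Nullary.Decidable using (_→-dec_; decidable-stable; via-injection)
import Relation.Binary.Reasoning.Setoid as SetoidReasoning
open import Algebra.Bundles using (CommutativeRing)
import Algebra.Properties.AbelianGroup as AbelianGroupProperties
import Algebra.Properties.CommutativeMonoid.Sum as SumProperties
import Algebra.Properties.CommutativeSemigroup as CommutativeSemigroupProperties

open HasCard

HasCard-unique : ∀ {A : Set} {_≈_ : Rel A 0ℓ} {m n} →
                 HasCard A _≈_ m → HasCard A _≈_ n → m ≡ n
HasCard-unique H K = Perm.↔⇒≡ (permutation (to K ∘ from H) (to H ∘ from K) (round-trip H K) (round-trip K H))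
  where
  round-trip : ∀ {m n} (H : HasCard _ _ m) (K : HasCard _ _ n) i → to K (from H (to H (from K i))) ≡ i
  round-trip H K i = trans (to-cong K _ _ (from-to H (from K i))) (to-from K i)

HasCard-transport : ∀ {A B : Set} {_≈ᴬ_ : Rel A 0ℓ} {_≈ᴮ_ : Rel B 0ℓ} {n} →
  Transitive _≈ᴬ_ → (f : A → B) (g : B → A) →
  (∀ {x y} → x ≈ᴬ y → f x ≈ᴮ f y) → (∀ {x y} → x ≈ᴮ y → g x ≈ᴬ g y) →
  (∀ x → g (f x) ≈ᴬ x) → (∀ y → f (g y) ≈ᴮ y) →
  HasCard B _≈ᴮ_ n → HasCard A _≈ᴬ_ n
HasCard-transport trans-≈ f g f-cong g-cong g∘f f∘g H = record
  { to      = to H ∘ f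
  ; from    = g ∘ from H
  ; to-cong = λ _ _ x≈y → to-cong H _ _ (f-cong x≈y)
  ; from-to = λ x → trans-≈ (g-cong (from-to H (f x))) (g∘f x)
  ; to-from = λ i → trans (to-cong H _ _ (f∘g (from H i))) (to-from H i)
  }

HasCard-Fin : ∀ n → HasCard (Fin n) _≡_ n
HasCard-Fin n = record
  { to = id ; from = id ; to-cong = λ _ _ → id ; from-to = λ _ → refl ; to-from = λ _ → refl }

HasCard-× : ∀ {A B : Set} {_≈ᴬ_ : Rel A 0ℓ} {_≈ᴮ_ : Rel B 0ℓ} {m n} →
  HasCard A _≈ᴬ_ m → HasCard B _≈ᴮ_ n → HasCard (A × B) (Product.Pointwise _≈ᴬ_ _≈ᴮ_) (m * n)
HasCard-× {_≈ᴬ_ = _≈ᴬ_} {_≈ᴮ_} {m} {n} H K = record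
  { to      = to′
  ; from    = from′
  ; to-cong = λ _ _ (a≈ , b≈) → cong₂ combine (to-cong H _ _ a≈) (to-cong K _ _ b≈)
  ; from-to = λ (a , b) → subst (λ (i , j) → from H i ≈ᴬ a × from K j ≈ᴮ b)
                            (sym (Fin.remQuot-combine (to H a) (to K b))) (from-to H a , from-to K b)
  ; to-from = λ i → trans (cong₂ combine (to-from H _) (to-from K _)) (Fin.combine-remQuot {m} n i)
  }
  where
  to′ : _ × _ → Fin (m * n)
  to′ (a , b) = combine (to H a) (to K b)
  from′ : Fin (m * n) → _ × _
  from′ i = let (j , k) = remQuot {m} n i in from H j , from K k

HasCard-Vector : ∀ {A : Set} {_≈_ : Rel A 0ℓ} {n} → Reflexive _≈_ → Transitive _≈_ →
  HasCard A _≈_ n → ∀ k → HasCard (Fin k → A) (Vector.Pointwise _≈_) (n ^ k)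
HasCard-Vector refl-≈ trans-≈ H zero = record
  { to = λ _ → zero ; from = λ _ () ; to-cong = λ _ _ _ → refl
  ; from-to = λ _ () ; to-from = λ { zero → refl } }
HasCard-Vector refl-≈ trans-≈ H (suc k) =
  HasCard-transport (λ v≈w w≈u i → trans-≈ (v≈w i) (w≈u i)) (λ v → head v , tail v) (uncurry _∷_)
    (λ v≈w → v≈w zero , v≈w ∘ suc) (λ { (x≈y , v≈w) → λ { zero → x≈y ; (suc i) → v≈w i } })
    (λ { v zero → refl-≈ ; v (suc i) → refl-≈ }) (λ _ → refl-≈ , λ _ → refl-≈)
    (HasCard-× H (HasCard-Vector refl-≈ trans-≈ H k))

HasCard-¬∀⇒∃¬ : ∀ {A : Set} {_≈_ : Rel A 0ℓ} {n} → HasCard A _≈_ n →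
  (P : A → Set) → (∀ x → Dec (P x)) → (∀ {x y} → x ≈ y → P x → P y) →
  ¬ (∀ x → P x) → ∃ λ x → ¬ P x
HasCard-¬∀⇒∃¬ {n = n} H P P? P-resp ¬∀P =
  let (i , ¬Pᵢ) = Fin.¬∀⟶∃¬ n (P ∘ from H) (P? ∘ from H) (λ ∀P → ¬∀P (λ x → P-resp (from-to H x) (∀P (to H x))))
  in from H i , ¬Pᵢ

↑-elim : ∀ m {n} {P : Fin (m + n) → Set} →
  (∀ i → P (i ↑ˡ n)) → (∀ j → P (m ↑ʳ j)) → ∀ k → P k
↑-elim zero    P-left P-right k       = P-right k
↑-elim (suc m) P-left P-right zero    = P-left zero
↑-elim (suc m) P-left P-right (suc k) = ↑-elim m (P-left ∘ suc) P-right k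

extend-injection : ∀ {r s l} → r + s ≡ l → (σ : Fin r → Fin l) → Injective _≡_ _≡_ σ →
  Σ (Permutation (r + s) l) λ π → ∀ i → π ⟨$⟩ʳ (i ↑ˡ s) ≡ σ i
extend-injection {zero}  r+s≡l σ σ-inj = Perm.cast-id r+s≡l , λ ()
extend-injection {suc r} {s} {suc l} r+s≡l σ σ-inj = Perm.insert zero (σ zero) π , π-↑ˡ
  where
  σ₀≢σ : ∀ i → σ zero ≢ σ (suc i)
  σ₀≢σ i σ₀≡σᵢ with () ← σ-inj σ₀≡σᵢ
  σ′ : Fin r → Fin l
  σ′ i = punchOut (σ₀≢σ i)
  extension : Σ (Permutation (r + s) l) λ π → ∀ i → π ⟨$⟩ʳ (i ↑ˡ s) ≡ σ′ i
  extension = extend-injection (ℕ.suc-injective r+s≡l) σ′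
                (Fin.suc-injective ∘ σ-inj ∘ Fin.punchOut-injective (σ₀≢σ _) (σ₀≢σ _))
  π : Permutation (r + s) l
  π = proj₁ extension
  π-↑ˡ : ∀ i → Perm.insert zero (σ zero) π ⟨$⟩ʳ (i ↑ˡ s) ≡ σ i
  π-↑ˡ zero    = refl
  π-↑ˡ (suc i) = begin
    Perm.insert zero (σ zero) π ⟨$⟩ʳ suc (i ↑ˡ s) ≡⟨ Perm.insert-punchIn zero (σ zero) π (i ↑ˡ s) ⟩
    Fin.punchIn (σ zero) (π ⟨$⟩ʳ (i ↑ˡ s))        ≡⟨ cong (Fin.punchIn (σ zero)) (proj₂ extension i) ⟩
    Fin.punchIn (σ zero) (σ′ i)                     ≡⟨ Fin.punchIn-punchOut (σ₀≢σ i) ⟩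
    σ (suc i)                                       ∎
    where open ≡-Reasoning

injective⇒permutation : ∀ {n} (σ : Fin n → Fin n) → Injective _≡_ _≡_ σ →
  Σ (Permutation n n) λ π → ∀ i → π ⟨$⟩ʳ i ≡ σ i
injective⇒permutation {n} σ σ-inj =
  Perm.cast-id (sym (ℕ.+-identityʳ n)) ∘ₚ π , λ i → trans (cong (π ⟨$⟩ʳ_) (cast≡↑ˡ i)) (π-↑ˡ i)
  where
  extension : Σ (Permutation (n + 0) n) λ π → ∀ i → π ⟨$⟩ʳ (i ↑ˡ 0) ≡ σ i
  extension = extend-injection (ℕ.+-identityʳ n) σ σ-inj
  π : Permutation (n + 0) n
  π = proj₁ extension
  π-↑ˡ : ∀ i → π ⟨$⟩ʳ (i ↑ˡ 0) ≡ σ i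
  π-↑ˡ = proj₂ extension
  cast≡↑ˡ : ∀ i → Fin.cast (sym (ℕ.+-identityʳ n)) i ≡ i ↑ˡ 0
  cast≡↑ˡ i = Fin.toℕ-injective (trans (Fin.toℕ-cast _ i) (sym (Fin.toℕ-↑ˡ i 0)))

module LinearAlgebra (F : Field) where
  open Field F hiding (_+_; _*_)
  open Field F using () renaming (_+_ to _⊕_; _*_ to _·_)
  open ≡-Reasoning

  ring : CommutativeRing 0ℓ 0ℓ
  ring = record { isCommutativeRing = isCommutativeRing }

  open CommutativeRing ring
    using (+-assoc; +-identityˡ; +-identityʳ; -‿inverseˡ; -‿inverseʳ; *-assoc; *-identityˡ;
           zeroˡ; zeroʳ; distribˡ; distribʳ; +-abelianGroup; +-commutativeSemigroup)
  open AbelianGroupProperties +-abelianGroup using (inverseˡ-unique; ε⁻¹≈ε)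
  open CommutativeSemigroupProperties +-commutativeSemigroup using (interchange; x∙yz≈xz∙y)

  ⊕-cancel-zeroʳ : ∀ {x y} → y ≡ 0# → x ⊕ y ≡ 0# → x ≡ 0#
  ⊕-cancel-zeroʳ {x} y≡0 x⊕y≡0 = trans (sym (trans (cong (x ⊕_) y≡0) (+-identityʳ x))) x⊕y≡0

  ⊕-cancel-zeroˡ : ∀ {x y} → x ≡ 0# → x ⊕ y ≡ 0# → y ≡ 0#
  ⊕-cancel-zeroˡ {x} {y} x≡0 x⊕y≡0 = trans (sym (trans (cong (_⊕ y) x≡0) (+-identityˡ y))) x⊕y≡0

  infix 4 _≋_
  _≋_ : ∀ {a b} → Mat F a b → Mat F a b → Set
  _≋_ = _≈M_ F

  ≋-sym : ∀ {a b} {A B : Mat F a b} → A ≋ B → B ≋ A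
  ≋-sym A≋B i j = sym (A≋B i j)

  ≋-trans : ∀ {a b} {A B C : Mat F a b} → A ≋ B → B ≋ C → A ≋ C
  ≋-trans A≋B B≋C i j = trans (A≋B i j) (B≋C i j)

  ++-≋ : ∀ {r s n} {u u′ : Mat F r n} {w w′ : Mat F s n} → u ≋ u′ → w ≋ w′ → (u ++ w) ≋ (u′ ++ w′)
  ++-≋ = Vector.++⁺ (Vector.Pointwise _≡_)

  ∑ : ∀ {k} → (Fin k → Carrier) → Carrier
  ∑ = sumF F

  ∑-cong : ∀ {k} {f g : Fin k → Carrier} → f ≗ g → ∑ f ≡ ∑ g
  ∑-cong {zero}  f≗g = refl
  ∑-cong {suc k} f≗g = cong₂ _⊕_ (f≗g zero) (∑-cong (f≗g ∘ suc))

  ∑-zero : ∀ {k} → ∑ {k} (λ _ → 0#) ≡ 0#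
  ∑-zero {zero}  = refl
  ∑-zero {suc k} = trans (+-identityˡ _) (∑-zero {k})

  ∑-⊕ : ∀ {k} (f g : Fin k → Carrier) → ∑ (λ i → f i ⊕ g i) ≡ ∑ f ⊕ ∑ g
  ∑-⊕ {zero}  f g = sym (+-identityˡ 0#)
  ∑-⊕ {suc k} f g = trans (cong (f zero ⊕ g zero ⊕_) (∑-⊕ (f ∘ suc) (g ∘ suc))) (interchange _ _ _ _)

  ·-distribˡ-∑ : ∀ {k} a (f : Fin k → Carrier) → a · ∑ f ≡ ∑ (λ i → a · f i)
  ·-distribˡ-∑ {zero}  a f = zeroʳ a
  ·-distribˡ-∑ {suc k} a f = trans (distribˡ a _ _) (cong (a · f zero ⊕_) (·-distribˡ-∑ a (f ∘ suc)))

  ·-distribʳ-∑ : ∀ {k} a (f : Fin k → Carrier) → ∑ f · a ≡ ∑ (λ i → f i · a)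
  ·-distribʳ-∑ {zero}  a f = zeroˡ a
  ·-distribʳ-∑ {suc k} a f = trans (distribʳ a _ _) (cong (f zero · a ⊕_) (·-distribʳ-∑ a (f ∘ suc)))

  ∑-↑ : ∀ r {s} (f : Fin (r + s) → Carrier) → ∑ f ≡ ∑ (f ∘ (_↑ˡ s)) ⊕ ∑ (f ∘ (r ↑ʳ_))
  ∑-↑ zero    f = sym (+-identityˡ _)
  ∑-↑ (suc r) f = trans (cong (f zero ⊕_) (∑-↑ r (f ∘ suc))) (sym (+-assoc _ _ _))

  ∑-comm : ∀ {m n} (f : Fin m → Fin n → Carrier) → ∑ (λ i → ∑ (f i)) ≡ ∑ (λ j → ∑ (λ i → f i j))
  ∑-comm {zero} {n} f = sym (∑-zero {n})
  ∑-comm {suc m} f = trans (cong (∑ (f zero) ⊕_) (∑-comm (f ∘ suc))) (sym (∑-⊕ (f zero) _))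

  ∑-single : ∀ {k} (f : Fin k → Carrier) i → (∀ j → j ≢ i → f j ≡ 0#) → ∑ f ≡ f i
  ∑-single {suc k} f zero    f-off = begin
    f zero ⊕ ∑ (f ∘ suc)          ≡⟨ cong (f zero ⊕_) (trans (∑-cong (λ j → f-off (suc j) λ ())) (∑-zero {k})) ⟩
    f zero ⊕ 0#                   ≡⟨ +-identityʳ _ ⟩
    f zero                        ∎
  ∑-single {suc k} f (suc i) f-off = begin
    f zero ⊕ ∑ (f ∘ suc)          ≡⟨ cong₂ _⊕_ (f-off zero λ ()) (∑-single (f ∘ suc) i λ j j≢i → f-off (suc j) (j≢i ∘ Fin.suc-injective)) ⟩
    0# ⊕ f (suc i)                ≡⟨ +-identityˡ _ ⟩
    f (suc i)                     ∎

  ∑-permute : ∀ {m n} (π : Permutation m n) (f : Fin n → Carrier) → ∑ f ≡ ∑ (f ∘ (π ⟨$⟩ʳ_))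
  ∑-permute π f = begin
    ∑ f                  ≡⟨ ∑≡sum f ⟩
    sum f                ≡⟨ sum-permute f π ⟩
    sum (f ∘ (π ⟨$⟩ʳ_))  ≡⟨ ∑≡sum (f ∘ (π ⟨$⟩ʳ_)) ⟨
    ∑ (f ∘ (π ⟨$⟩ʳ_))    ∎
    where
    open SumProperties (CommutativeRing.+-commutativeMonoid ring) using (sum) renaming (∑-permute to sum-permute)
    ∑≡sum : ∀ {k} (f : Fin k → Carrier) → ∑ f ≡ sum f
    ∑≡sum {zero}  f = refl
    ∑≡sum {suc k} f = cong (f zero ⊕_) (∑≡sum (f ∘ suc))

  lincomb : ∀ {k n} → (Fin k → Carrier) → Mat F k n → Fin n → Carrier
  lincomb c v j = ∑ (λ i → c i · v i j)

  lincomb-cong : ∀ {k n} {c c′ : Fin k → Carrier} {v w : Mat F k n} →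
    c ≗ c′ → v ≋ w → ∀ j → lincomb c v j ≡ lincomb c′ w j
  lincomb-cong c≗c′ v≋w j = ∑-cong (λ i → cong₂ _·_ (c≗c′ i) (v≋w i j))

  lincomb-congˡ : ∀ {k n} {c c′ : Fin k → Carrier} (v : Mat F k n) → c ≗ c′ → ∀ j → lincomb c v j ≡ lincomb c′ v j
  lincomb-congˡ v c≗c′ = lincomb-cong c≗c′ (λ _ _ → refl)

  lincomb-⊕ˡ : ∀ {k n} (c c′ : Fin k → Carrier) (v : Mat F k n) j →
    lincomb (λ i → c i ⊕ c′ i) v j ≡ lincomb c v j ⊕ lincomb c′ v j
  lincomb-⊕ˡ c c′ v j = trans (∑-cong (λ i → distribʳ (v i j) (c i) (c′ i)))
    (∑-⊕ (λ i → c i · v i j) (λ i → c′ i · v i j))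

  lincomb-⊕ʳ : ∀ {k n} (c : Fin k → Carrier) (v w : Mat F k n) j →
    lincomb c (λ i j → v i j ⊕ w i j) j ≡ lincomb c v j ⊕ lincomb c w j
  lincomb-⊕ʳ c v w j = trans (∑-cong (λ i → distribˡ (c i) (v i j) (w i j)))
    (∑-⊕ (λ i → c i · v i j) (λ i → c i · w i j))

  lincomb-zeroˡ : ∀ {k n} (v : Mat F k n) j → lincomb (λ _ → 0#) v j ≡ 0#
  lincomb-zeroˡ {k} v j = trans (∑-cong (λ i → zeroˡ (v i j))) (∑-zero {k})

  lincomb-zeroʳ : ∀ {k n} (c : Fin k → Carrier) (v : Mat F k n) j → (∀ i → v i j ≡ 0#) → lincomb c v j ≡ 0#
  lincomb-zeroʳ {k} c v j vⱼ≡0 = trans (∑-cong (λ i → trans (cong (c i ·_) (vⱼ≡0 i)) (zeroʳ (c i)))) (∑-zero {k})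

  lincomb-neg : ∀ {k n} (c : Fin k → Carrier) (v : Mat F k n) j → lincomb (λ i → - c i) v j ≡ - lincomb c v j
  lincomb-neg c v j = inverseˡ-unique _ _ (begin
    lincomb (λ i → - c i) v j ⊕ lincomb c v j ≡⟨ lincomb-⊕ˡ (λ i → - c i) c v j ⟨
    lincomb (λ i → - c i ⊕ c i) v j          ≡⟨ lincomb-congˡ v (λ i → -‿inverseˡ (c i)) j ⟩
    lincomb (λ _ → 0#) v j                   ≡⟨ lincomb-zeroˡ v j ⟩
    0#                                       ∎)

  lincomb-scale : ∀ {k n} a (c : Fin k → Carrier) (v : Mat F k n) j → lincomb (λ i → a · c i) v j ≡ a · lincomb c v j
  lincomb-scale a c v j = trans (∑-cong (λ i → *-assoc a (c i) (v i j))) (sym (·-distribˡ-∑ a (λ i → c i · v i j)))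

  lincomb-lincomb : ∀ {r s n} (b : Fin s → Carrier) (μ : Mat F s r) (u : Mat F r n) j →
    lincomb b (λ t → lincomb (μ t) u) j ≡ lincomb (lincomb b μ) u j
  lincomb-lincomb b μ u j = begin
    ∑ (λ t → b t · ∑ (λ i → μ t i · u i j))     ≡⟨ ∑-cong (λ t → ·-distribˡ-∑ (b t) (λ i → μ t i · u i j)) ⟩
    ∑ (λ t → ∑ (λ i → b t · (μ t i · u i j)))   ≡⟨ ∑-comm (λ t i → b t · (μ t i · u i j)) ⟩
    ∑ (λ i → ∑ (λ t → b t · (μ t i · u i j)))   ≡⟨ ∑-cong (λ i → ∑-cong (λ t → *-assoc (b t) (μ t i) (u i j))) ⟨
    ∑ (λ i → ∑ (λ t → b t · μ t i · u i j))     ≡⟨ ∑-cong (λ i → ·-distribʳ-∑ (u i j) (λ t → b t · μ t i)) ⟨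
    ∑ (λ i → ∑ (λ t → b t · μ t i) · u i j)     ∎

  lincomb-↑ : ∀ {r s n} (c : Fin (r + s) → Carrier) (u : Mat F r n) (w : Mat F s n) j →
    lincomb c (u ++ w) j ≡ lincomb (c ∘ (_↑ˡ s)) u j ⊕ lincomb (c ∘ (r ↑ʳ_)) w j
  lincomb-↑ {r} {s} c u w j = trans (∑-↑ r _) (cong₂ _⊕_
    (∑-cong (λ i → cong (λ x → c (i ↑ˡ s) · x j) (lookup-++ˡ u w i)))
    (∑-cong (λ i → cong (λ x → c (r ↑ʳ i) · x j) (lookup-++ʳ u w i))))

  lincomb-++ : ∀ {r s n} (a : Fin r → Carrier) (b : Fin s → Carrier) (u : Mat F r n) (w : Mat F s n) j →
    lincomb (a ++ b) (u ++ w) j ≡ lincomb a u j ⊕ lincomb b w j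
  lincomb-++ a b u w j = trans (lincomb-↑ (a ++ b) u w j) (cong₂ _⊕_
    (lincomb-congˡ u (lookup-++ˡ a b) j) (lincomb-congˡ w (lookup-++ʳ a b) j))

  lincomb-permute : ∀ {m n k} (π : Permutation m n) (c : Fin n → Carrier) (v : Mat F n k) j →
    lincomb (c ∘ (π ⟨$⟩ʳ_)) (v ∘ (π ⟨$⟩ʳ_)) j ≡ lincomb c v j
  lincomb-permute π c v j = sym (∑-permute π _)

  shear : ∀ {r s n} → Mat F s r → Mat F r n → Mat F s n → Mat F s n
  shear μ u w t j = w t j ⊕ lincomb (μ t) u j

  shear-cong : ∀ {r s n} (μ : Mat F s r) {u u′ : Mat F r n} {w w′ : Mat F s n} →
    u ≋ u′ → w ≋ w′ → shear μ u w ≋ shear μ u′ w′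
  shear-cong μ u≋u′ w≋w′ t j = cong₂ _⊕_ (w≋w′ t j) (lincomb-cong (λ _ → refl) u≋u′ j)

  shear-cancel : ∀ {r s n} {μ ν : Mat F s r} → (∀ t i → μ t i ⊕ ν t i ≡ 0#) →
    (u : Mat F r n) (w : Mat F s n) → shear ν u (shear μ u w) ≋ w
  shear-cancel {μ = μ} {ν} μ+ν≡0 u w t j = begin
    (w t j ⊕ lincomb (μ t) u j) ⊕ lincomb (ν t) u j ≡⟨ +-assoc _ _ _ ⟩
    w t j ⊕ (lincomb (μ t) u j ⊕ lincomb (ν t) u j) ≡⟨ cong (w t j ⊕_) (lincomb-⊕ˡ (μ t) (ν t) u j) ⟨
    w t j ⊕ lincomb (λ i → μ t i ⊕ ν t i) u j       ≡⟨ cong (w t j ⊕_) (trans (lincomb-congˡ u (μ+ν≡0 t) j) (lincomb-zeroˡ u j)) ⟩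
    w t j ⊕ 0#                                      ≡⟨ +-identityʳ _ ⟩
    w t j                                           ∎

  lincomb-shear : ∀ {r s n} (a : Fin r → Carrier) (b : Fin s → Carrier) (μ : Mat F s r) (u : Mat F r n) (w : Mat F s n) j →
    lincomb a u j ⊕ lincomb b (shear μ u w) j ≡ lincomb (λ i → a i ⊕ lincomb b μ i) u j ⊕ lincomb b w j
  lincomb-shear a b μ u w j = begin
    lincomb a u j ⊕ lincomb b (shear μ u w) j
      ≡⟨ cong (lincomb a u j ⊕_) (lincomb-⊕ʳ b w (λ t → lincomb (μ t) u) j) ⟩
    lincomb a u j ⊕ (lincomb b w j ⊕ lincomb b (λ t → lincomb (μ t) u) j)
      ≡⟨ cong (λ x → lincomb a u j ⊕ (lincomb b w j ⊕ x)) (lincomb-lincomb b μ u j) ⟩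
    lincomb a u j ⊕ (lincomb b w j ⊕ lincomb (lincomb b μ) u j)
      ≡⟨ x∙yz≈xz∙y _ _ _ ⟩
    (lincomb a u j ⊕ lincomb (lincomb b μ) u j) ⊕ lincomb b w j
      ≡⟨ cong (_⊕ lincomb b w j) (lincomb-⊕ˡ a (lincomb b μ) u j) ⟨
    lincomb (λ i → a i ⊕ lincomb b μ i) u j ⊕ lincomb b w j
      ∎

  LinIndep-≋ : ∀ {k n} {v w : Mat F k n} → v ≋ w → LinIndep F v ⇔ LinIndep F w
  LinIndep-≋ v≋w = mk⇔ (transport v≋w) (transport (≋-sym v≋w))
    where
    transport : ∀ {v w} → v ≋ w → LinIndep F v → LinIndep F w
    transport {v} {w} v≋w v-indep c c-kills-w =
      v-indep c (λ j → trans (lincomb-cong (λ _ → refl) v≋w j) (c-kills-w j))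

  permute-LinIndep : ∀ {m n k} (π : Permutation m n) {v : Mat F n k} →
    LinIndep F v → LinIndep F (v ∘ (π ⟨$⟩ʳ_))
  permute-LinIndep π {v} v-indep c c-kills i = begin
    c i                          ≡⟨ cong c (Perm.inverseˡ π) ⟨
    c (π ⟨$⟩ˡ (π ⟨$⟩ʳ i))        ≡⟨ v-indep (c ∘ (π ⟨$⟩ˡ_)) c′-kills (π ⟨$⟩ʳ i) ⟩
    0#                           ∎
    where
    c′-kills : ∀ j → lincomb (c ∘ (π ⟨$⟩ˡ_)) v j ≡ 0#
    c′-kills j = begin
      lincomb (c ∘ (π ⟨$⟩ˡ_)) v j                                ≡⟨ lincomb-permute π (c ∘ (π ⟨$⟩ˡ_)) v j ⟨
      lincomb (c ∘ (π ⟨$⟩ˡ_) ∘ (π ⟨$⟩ʳ_)) (v ∘ (π ⟨$⟩ʳ_)) j      ≡⟨ lincomb-congˡ (v ∘ (π ⟨$⟩ʳ_)) (λ _ → cong c (Perm.inverseˡ π)) j ⟩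
      lincomb c (v ∘ (π ⟨$⟩ʳ_)) j                                ≡⟨ c-kills j ⟩
      0#                                                         ∎

  LinIndep-permute : ∀ {m n k} (π : Permutation m n) {v : Mat F n k} →
    LinIndep F v ⇔ LinIndep F (v ∘ (π ⟨$⟩ʳ_))
  LinIndep-permute π {v} = mk⇔ (permute-LinIndep π) λ vπ-indep →
    Equivalence.to (LinIndep-≋ (λ i j → cong (λ x → v x j) (Perm.inverseʳ π))) (permute-LinIndep (Perm.flip π) vπ-indep)

  -- A dependency (a , b) of (u ; w + μ u) yields the dependency (a + b μ , b) of (u ; w).
  shear-LinIndep : ∀ {r s n} (μ : Mat F s r) {u : Mat F r n} {w : Mat F s n} →
    LinIndep F (u ++ w) → LinIndep F (u ++ shear μ u w)
  shear-LinIndep {r} {s} μ {u} {w} indep c c-kills = ↑-elim r a≡0 b≡0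
    where
    a : Fin r → Carrier
    a = c ∘ (_↑ˡ s)
    b : Fin s → Carrier
    b = c ∘ (r ↑ʳ_)
    a′ : Fin r → Carrier
    a′ i = a i ⊕ lincomb b μ i
    a′b≡0 : ∀ x → (a′ ++ b) x ≡ 0#
    a′b≡0 = indep (a′ ++ b) λ j → begin
      lincomb (a′ ++ b) (u ++ w) j               ≡⟨ lincomb-++ a′ b u w j ⟩
      lincomb a′ u j ⊕ lincomb b w j             ≡⟨ lincomb-shear a b μ u w j ⟨
      lincomb a u j ⊕ lincomb b (shear μ u w) j  ≡⟨ lincomb-↑ c u (shear μ u w) j ⟨
      lincomb c (u ++ shear μ u w) j             ≡⟨ c-kills j ⟩
      0#                                         ∎
    b≡0 : ∀ t → b t ≡ 0#
    b≡0 t = trans (sym (lookup-++ʳ a′ b t)) (a′b≡0 (r ↑ʳ t))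
    a≡0 : ∀ i → a i ≡ 0#
    a≡0 i = ⊕-cancel-zeroʳ (trans (lincomb-congˡ μ b≡0 i) (lincomb-zeroˡ μ i))
                           (trans (sym (lookup-++ˡ a′ b i)) (a′b≡0 (i ↑ˡ s)))

  LinIndep-shear : ∀ {r s n} (μ : Mat F s r) {u : Mat F r n} {w : Mat F s n} →
    LinIndep F (u ++ w) ⇔ LinIndep F (u ++ shear μ u w)
  LinIndep-shear μ {u} {w} = mk⇔ (shear-LinIndep μ) λ sheared-indep →
    Equivalence.to (LinIndep-≋ (++-≋ {u = u} (λ _ _ → refl) (shear-cancel (λ t i → -‿inverseʳ (μ t i)) u w)))
      (shear-LinIndep (λ t i → - μ t i) sheared-indep)

  rightBlock : ∀ {l} m₁ m₂ → Mat F l (m₁ + m₂) → Mat F l m₂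
  rightBlock m₁ m₂ A i j = A i (m₁ ↑ʳ j)

  _∣_ : ∀ {l m₁ m₂} → Mat F l m₁ → Mat F l m₂ → Mat F l (m₁ + m₂)
  (A ∣ B) k = A k ++ B k

  ∣-cong : ∀ {l m₁ m₂} {A A′ : Mat F l m₁} {B B′ : Mat F l m₂} → A ≋ A′ → B ≋ B′ → (A ∣ B) ≋ (A′ ∣ B′)
  ∣-cong A≋A′ B≋B′ k = Vector.++⁺ _≡_ (A≋A′ k) (B≋B′ k)

  leftBlock-∣ : ∀ {l m₁ m₂} (A : Mat F l m₁) (B : Mat F l m₂) → leftBlock F m₁ m₂ (A ∣ B) ≋ A
  leftBlock-∣ A B k = lookup-++ˡ (A k) (B k)

  rightBlock-∣ : ∀ {l m₁ m₂} (A : Mat F l m₁) (B : Mat F l m₂) → rightBlock m₁ m₂ (A ∣ B) ≋ B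
  rightBlock-∣ A B k = lookup-++ʳ (A k) (B k)

  leftBlock∣rightBlock : ∀ {l m₁ m₂} (M : Mat F l (m₁ + m₂)) → (leftBlock F m₁ m₂ M ∣ rightBlock m₁ m₂ M) ≋ M
  leftBlock∣rightBlock {m₁ = m₁} {m₂} M k = ↑-elim m₁ (lookup-++ˡ (leftBlock F m₁ m₂ M k) (rightBlock m₁ m₂ M k))
                                                     (lookup-++ʳ (leftBlock F m₁ m₂ M k) (rightBlock m₁ m₂ M k))

  LinIndep-blockTriangular : ∀ {r s} m₁ m₂ {u : Mat F r (m₁ + m₂)} {w : Mat F s (m₁ + m₂)} →
    LinIndep F (leftBlock F m₁ m₂ u) → (∀ t j → leftBlock F m₁ m₂ w t j ≡ 0#) →
    LinIndep F (u ++ w) ⇔ LinIndep F (rightBlock m₁ m₂ w)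
  LinIndep-blockTriangular {r} {s} m₁ m₂ {u} {w} u₁-indep w₁≡0 = mk⇔ to′ from′
    where
    lincomb-w₁ : ∀ b j → lincomb b w (j ↑ˡ m₂) ≡ 0#
    lincomb-w₁ b j = lincomb-zeroʳ b w (j ↑ˡ m₂) (λ t → w₁≡0 t j)

    to′ : LinIndep F (u ++ w) → LinIndep F (rightBlock m₁ m₂ w)
    to′ indep b b-kills t = trans (sym (lookup-++ʳ zeros b t)) (indep (zeros ++ b) zeros-b-kills (r ↑ʳ t))
      where
      zeros : Fin r → Carrier
      zeros _ = 0#
      zeros-b-kills : ∀ j → lincomb (zeros ++ b) (u ++ w) j ≡ 0#
      zeros-b-kills j = begin
        lincomb (zeros ++ b) (u ++ w) j     ≡⟨ lincomb-++ zeros b u w j ⟩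
        lincomb zeros u j ⊕ lincomb b w j   ≡⟨ cong (_⊕ lincomb b w j) (lincomb-zeroˡ u j) ⟩
        0# ⊕ lincomb b w j                  ≡⟨ +-identityˡ _ ⟩
        lincomb b w j                       ≡⟨ ↑-elim m₁ {P = λ j → lincomb b w j ≡ 0#} (lincomb-w₁ b) b-kills j ⟩
        0#                                  ∎

    from′ : LinIndep F (rightBlock m₁ m₂ w) → LinIndep F (u ++ w)
    from′ w₂-indep c c-kills = ↑-elim r a≡0 b≡0
      where
      a : Fin r → Carrier
      a = c ∘ (_↑ˡ s)
      b : Fin s → Carrier
      b = c ∘ (r ↑ʳ_)
      kills : ∀ j → lincomb a u j ⊕ lincomb b w j ≡ 0#
      kills j = trans (sym (lincomb-↑ c u w j)) (c-kills j)
      a≡0 : ∀ i → a i ≡ 0#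
      a≡0 = u₁-indep a λ j → ⊕-cancel-zeroʳ (lincomb-w₁ b j) (kills (j ↑ˡ m₂))
      b≡0 : ∀ t → b t ≡ 0#
      b≡0 = w₂-indep b λ j → ⊕-cancel-zeroˡ (trans (lincomb-congˡ u a≡0 _) (lincomb-zeroˡ u _)) (kills (m₁ ↑ʳ j))

  indicator : ∀ {k} → Fin k → Fin k → Carrier
  indicator i x with i Fin.≟ x
  ... | yes _ = 1#
  ... | no  _ = 0#

  indicator-diagonal : ∀ {k} (i : Fin k) → indicator i i ≡ 1#
  indicator-diagonal i with i Fin.≟ i
  ... | yes _   = refl
  ... | no  i≢i = ⊥-elim (i≢i refl)

  indicator-off : ∀ {k} {i x : Fin k} → i ≢ x → indicator i x ≡ 0#
  indicator-off {i = i} {x} i≢x with i Fin.≟ x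
  ... | yes i≡x = ⊥-elim (i≢x i≡x)
  ... | no  _   = refl

  lincomb-indicator : ∀ {k n} (i : Fin k) (v : Mat F k n) j → lincomb (indicator i) v j ≡ v i j
  lincomb-indicator i v j = begin
    lincomb (indicator i) v j   ≡⟨ ∑-single (λ x → indicator i x · v x j) i (λ x x≢i → trans (cong (_· v x j) (indicator-off (x≢i ∘ sym))) (zeroˡ _)) ⟩
    indicator i i · v i j       ≡⟨ cong (_· v i j) (indicator-diagonal i) ⟩
    1# · v i j                  ≡⟨ *-identityˡ _ ⟩
    v i j                       ∎

  LinIndep⇒rows-injective : ∀ {k n} {v : Mat F k n} → LinIndep F v → ∀ {i i′} → (∀ j → v i j ≡ v i′ j) → i ≡ i′
  LinIndep⇒rows-injective {v = v} indep {i} {i′} vᵢ≡vᵢ′ with i Fin.≟ i′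
  ... | yes i≡i′ = i≡i′
  ... | no  i≢i′ = ⊥-elim (0≢1 (trans (sym (indep c c-kills i)) cᵢ≡1))
    where
    c : Fin _ → Carrier
    c x = indicator i x ⊕ - indicator i′ x
    cᵢ≡1 : c i ≡ 1#
    cᵢ≡1 = begin
      indicator i i ⊕ - indicator i′ i ≡⟨ cong₂ (λ x y → x ⊕ - y) (indicator-diagonal i) (indicator-off (i≢i′ ∘ sym)) ⟩
      1# ⊕ - 0#                        ≡⟨ cong (1# ⊕_) ε⁻¹≈ε ⟩
      1# ⊕ 0#                          ≡⟨ +-identityʳ 1# ⟩
      1#                               ∎
    c-kills : ∀ j → lincomb c v j ≡ 0#
    c-kills j = begin
      lincomb c v j
        ≡⟨ lincomb-⊕ˡ (indicator i) (λ x → - indicator i′ x) v j ⟩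
      lincomb (indicator i) v j ⊕ lincomb (λ x → - indicator i′ x) v j
        ≡⟨ cong (lincomb (indicator i) v j ⊕_) (lincomb-neg (indicator i′) v j) ⟩
      lincomb (indicator i) v j ⊕ - lincomb (indicator i′) v j
        ≡⟨ cong₂ (λ x y → x ⊕ - y) (lincomb-indicator i v j) (lincomb-indicator i′ v j) ⟩
      v i j ⊕ - v i′ j
        ≡⟨ cong (_⊕ - v i′ j) (vᵢ≡vᵢ′ j) ⟩
      v i′ j ⊕ - v i′ j
        ≡⟨ -‿inverseʳ _ ⟩
      0# ∎

  LinIndep-rows⇒injective : ∀ {k a n} (A : Mat F a n) {σ : Fin k → Fin a} →
    LinIndep F (λ i → A (σ i)) → Injective _≡_ _≡_ σ
  LinIndep-rows⇒injective A indep σᵢ≡σᵢ′ = LinIndep⇒rows-injective indep (λ j → cong (λ x → A x j) σᵢ≡σᵢ′)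

  LinIndep⇒HasRank : ∀ {a n} {A : Mat F a n} → LinIndep F A → HasRank F A a
  LinIndep⇒HasRank {a} {A = A} indep = (id , indep) , λ σ σ-indep →
    let (i , j , i<j , σᵢ≡σⱼ) = Fin.pigeonhole (ℕ.n<1+n a) σ
    in Fin.<⇒≢ i<j (LinIndep-rows⇒injective A {σ} σ-indep σᵢ≡σⱼ)

  HasRank⇒LinIndep : ∀ {a n} {A : Mat F a n} → HasRank F A a → LinIndep F A
  HasRank⇒LinIndep {A = A} ((σ , σ-indep) , _) =
    let (π , π≗σ) = injective⇒permutation σ (LinIndep-rows⇒injective A σ-indep)
    in Equivalence.from (LinIndep-permute π)
         (Equivalence.to (LinIndep-≋ (λ i j → cong (λ x → A x j) (sym (π≗σ i)))) σ-indep)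

  HasRank-cong : ∀ {a n r} {A B : Mat F a n} → A ≋ B → HasRank F A r → HasRank F B r
  HasRank-cong A≋B ((σ , σ-indep) , maximal) =
    (σ , Equivalence.to (LinIndep-≋ (λ i → A≋B (σ i))) σ-indep) ,
    λ σ′ σ′-indep → maximal σ′ (Equivalence.from (LinIndep-≋ (λ i → A≋B (σ′ i))) σ′-indep)

module FiniteField (F : Field) {q : ℕ} (size : HasSize F q) where
  open Field F hiding (_+_; _*_)
  open Field F using () renaming (_+_ to _⊕_; _*_ to _·_)
  open LinearAlgebra F
  open CommutativeRing ring using (-‿inverseˡ; -‿inverseʳ; *-assoc; *-comm; *-identityˡ; zeroˡ; +-abelianGroup)
  open AbelianGroupProperties +-abelianGroup using (inverseˡ-unique)

  _≟_ : DecidableEquality Carrier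
  _≟_ = via-injection (↔⇒↣ size) Fin._≟_

  HasCard-Carrier : HasCard Carrier _≡_ q
  HasCard-Carrier = record
    { to = Inverse.to size ; from = Inverse.from size ; to-cong = λ _ _ → cong (Inverse.to size)
    ; from-to = Inverse.strictlyInverseʳ size ; to-from = Inverse.strictlyInverseˡ size }

  HasCard-Vec : ∀ k → HasCard (Fin k → Carrier) (Vector.Pointwise _≡_) (q ^ k)
  HasCard-Vec = HasCard-Vector refl trans HasCard-Carrier

  HasCard-Mat : ∀ a b → HasCard (Mat F a b) _≋_ ((q ^ b) ^ a)
  HasCard-Mat a b = HasCard-Vector (λ _ → refl) (λ v≗w w≗u i → trans (v≗w i) (w≗u i)) (HasCard-Vec b) a

  ¬LinIndep⇒dependence : ∀ {k n} (v : Mat F k n) → ¬ LinIndep F v →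
    ∃ λ c → (∀ j → lincomb c v j ≡ 0#) × ∃ λ i → c i ≢ 0#
  ¬LinIndep⇒dependence {k} v dependent =
    let (c , ¬Pc) = HasCard-¬∀⇒∃¬ (HasCard-Vec k) P P? P-resp dependent
    in c , decidable-stable (kills? c) (λ ¬kills → ¬Pc (⊥-elim ∘ ¬kills)) ,
           Fin.¬∀⟶∃¬ k _ (λ i → c i ≟ 0#) (λ c≡0 → ¬Pc (λ _ → c≡0))
    where
    Kills : (Fin k → Carrier) → Set
    Kills c = ∀ j → lincomb c v j ≡ 0#
    kills? : ∀ c → Dec (Kills c)
    kills? c = Fin.all? (λ j → lincomb c v j ≟ 0#)
    P : (Fin k → Carrier) → Set
    P c = Kills c → ∀ i → c i ≡ 0#
    P? : ∀ c → Dec (P c)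
    P? c = kills? c →-dec Fin.all? (λ i → c i ≟ 0#)
    P-resp : ∀ {c c′} → Vector.Pointwise _≡_ c c′ → P c → P c′
    P-resp c≗c′ Pc c′-kills i = trans (sym (c≗c′ i)) (Pc (λ j → trans (lincomb-congˡ v c≗c′ j) (c′-kills j)) i)

  lincomb-of-dependent : ∀ {k n} {u : Mat F k n} (x : Fin n → Carrier) → LinIndep F u → ¬ LinIndep F (x ∷ u) →
    ∃ λ μ → ∀ j → x j ≡ lincomb μ u j
  lincomb-of-dependent {u = u} x u-indep x∷u-dependent = μ , x≡μu
    where
    open ≡-Reasoning
    dependence : ∃ λ c → (∀ j → lincomb c (x ∷ u) j ≡ 0#) × ∃ λ i → c i ≢ 0#
    dependence = ¬LinIndep⇒dependence (x ∷ u) x∷u-dependent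
    c : Fin _ → Carrier
    c = proj₁ dependence
    c-kills : ∀ j → c zero · x j ⊕ lincomb (c ∘ suc) u j ≡ 0#
    c-kills = proj₁ (proj₂ dependence)
    c₀≢0 : c zero ≢ 0#
    c₀≢0 c₀≡0 = let (i , cᵢ≢0) = proj₂ (proj₂ dependence) in cᵢ≢0 (c≡0 i)
      where
      tail≡0 : ∀ i → c (suc i) ≡ 0#
      tail≡0 = u-indep (c ∘ suc) λ j → ⊕-cancel-zeroˡ (trans (cong (_· x j) c₀≡0) (zeroˡ (x j))) (c-kills j)
      c≡0 : ∀ i → c i ≡ 0#
      c≡0 zero    = c₀≡0
      c≡0 (suc i) = tail≡0 i
    y : Carrier
    y = proj₁ (inverse (c zero) c₀≢0)
    μ : Fin _ → Carrier
    μ i = y · - c (suc i)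
    x≡μu : ∀ j → x j ≡ lincomb μ u j
    x≡μu j = begin
      x j                                   ≡⟨ *-identityˡ (x j) ⟨
      1# · x j                              ≡⟨ cong (_· x j) (trans (sym (proj₂ (inverse (c zero) c₀≢0))) (*-comm _ _)) ⟩
      y · c zero · x j                      ≡⟨ *-assoc y (c zero) (x j) ⟩
      y · (c zero · x j)                    ≡⟨ cong (y ·_) (inverseˡ-unique _ _ (c-kills j)) ⟩
      y · - lincomb (c ∘ suc) u j           ≡⟨ cong (y ·_) (lincomb-neg (c ∘ suc) u j) ⟨
      y · lincomb (λ i → - c (suc i)) u j   ≡⟨ lincomb-scale y (λ i → - c (suc i)) u j ⟨
      lincomb μ u j                         ∎

  HasRank⇒spanned : ∀ {a n r} (A : Mat F a n) (A-rank : HasRank F A r) k →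
    ∃ λ μ → ∀ j → A k j ≡ lincomb μ (λ i → A (proj₁ (proj₁ A-rank) i)) j
  -- maximal (k ∷ σ) is, definitionally, the dependence of the rows A k ∷ A ∘ σ.
  HasRank⇒spanned A ((σ , σ-indep) , maximal) k = lincomb-of-dependent (A k) σ-indep (maximal (k ∷ σ))

  module Fibre {l m₁ r s : ℕ} (r+s≡l : r + s ≡ l) {A₁ : Mat F l m₁} (A₁-rank : HasRank F A₁ r) where
    σ : Fin r → Fin l
    σ = proj₁ (proj₁ A₁-rank)

    extension : Σ (Permutation (r + s) l) λ π → ∀ i → π ⟨$⟩ʳ (i ↑ˡ s) ≡ σ i
    extension = extend-injection r+s≡l σ (LinIndep-rows⇒injective A₁ (proj₂ (proj₁ A₁-rank)))

    π : Permutation (r + s) l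
    π = proj₁ extension

    τ : Fin s → Fin l
    τ t = π ⟨$⟩ʳ (r ↑ʳ t)

    μ : Mat F s r
    μ t = proj₁ (HasRank⇒spanned A₁ A₁-rank (τ t))

    basisRows : ∀ {n} → Mat F l n → Mat F r n
    basisRows A i = A (σ i)

    otherRows : ∀ {n} → Mat F l n → Mat F s n
    otherRows A t = A (τ t)

    residual : ∀ {n} → Mat F l n → Mat F s n
    residual A = shear (λ t i → - μ t i) (basisRows A) (otherRows A)

    complete : ∀ {n} → Mat F r n → Mat F s n → Mat F l n
    complete C D k = (C ++ shear μ C D) (π ⟨$⟩ˡ k)

    rows-π : ∀ {n} (A : Mat F l n) → (A ∘ (π ⟨$⟩ʳ_)) ≋ (basisRows A ++ otherRows A)
    rows-π A = ↑-elim r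
      (λ i j → trans (cong (λ k → A k j) (proj₂ extension i)) (sym (cong-app (lookup-++ˡ (basisRows A) (otherRows A) i) j)))
      (λ t j → sym (cong-app (lookup-++ʳ (basisRows A) (otherRows A) t) j))

    residual-cong : ∀ {n} {A A′ : Mat F l n} → A ≋ A′ → residual A ≋ residual A′
    residual-cong A≋A′ = shear-cong _ (A≋A′ ∘ σ) (A≋A′ ∘ τ)

    complete-cong : ∀ {n} {C C′ : Mat F r n} {D D′ : Mat F s n} → C ≋ C′ → D ≋ D′ → complete C D ≋ complete C′ D′
    complete-cong C≋C′ D≋D′ k = ++-≋ C≋C′ (shear-cong μ C≋C′ D≋D′) (π ⟨$⟩ˡ k)

    complete-reduce : ∀ {n} (A : Mat F l n) → complete (basisRows A) (residual A) ≋ A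
    complete-reduce A k j = trans (rows (π ⟨$⟩ˡ k) j) (cong (λ y → A y j) (Perm.inverseʳ π))
      where
      rows : (basisRows A ++ shear μ (basisRows A) (residual A)) ≋ (A ∘ (π ⟨$⟩ʳ_))
      rows = ≋-trans (++-≋ {u = basisRows A} (λ _ _ → refl) (shear-cancel (λ t i → -‿inverseˡ (μ t i)) _ _)) (≋-sym (rows-π A))

    module _ {n : ℕ} (C : Mat F r n) (D : Mat F s n) where
      private
        rows : (basisRows (complete C D) ++ otherRows (complete C D)) ≋ (C ++ shear μ C D)
        rows = ≋-trans (≋-sym (rows-π (complete C D))) λ x j → cong (λ y → (C ++ shear μ C D) y j) (Perm.inverseˡ π)

      basisRows-complete : basisRows (complete C D) ≋ C
      basisRows-complete = Vector.++⁻ˡ (Vector.Pointwise _≡_) _ _ rows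

      residual-complete : residual (complete C D) ≋ D
      residual-complete = ≋-trans (shear-cong _ basisRows-complete (Vector.++⁻ʳ (Vector.Pointwise _≡_) _ _ rows))
                                  (shear-cancel (λ t i → -‿inverseʳ (μ t i)) C D)

    residual-left≡0 : ∀ {m₂} (M : Mat F l (m₁ + m₂)) → leftBlock F m₁ m₂ M ≋ A₁ →
      ∀ t j → leftBlock F m₁ m₂ (residual M) t j ≡ 0#
    residual-left≡0 {m₂} M M₁≋A₁ t j = begin
      M (τ t) (j ↑ˡ m₂) ⊕ lincomb (λ i → - μ t i) (basisRows M) (j ↑ˡ m₂)
        ≡⟨ cong₂ _⊕_ (M₁≋A₁ (τ t) j) (lincomb-neg (μ t) (basisRows M) (j ↑ˡ m₂)) ⟩
      A₁ (τ t) j ⊕ - lincomb (μ t) (basisRows M) (j ↑ˡ m₂)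
        ≡⟨ cong (λ x → A₁ (τ t) j ⊕ - x) (lincomb-cong (λ _ → refl) (M₁≋A₁ ∘ σ) j) ⟩
      A₁ (τ t) j ⊕ - lincomb (μ t) (basisRows A₁) j
        ≡⟨ cong (λ x → A₁ (τ t) j ⊕ - x) (proj₂ (HasRank⇒spanned A₁ A₁-rank (τ t)) j) ⟨
      A₁ (τ t) j ⊕ - A₁ (τ t) j
        ≡⟨ -‿inverseʳ _ ⟩
      0# ∎
      where open ≡-Reasoning

    LinIndep⇔residual : ∀ {m₂} (M : Mat F l (m₁ + m₂)) → leftBlock F m₁ m₂ M ≋ A₁ →
      LinIndep F M ⇔ LinIndep F (residual (rightBlock m₁ m₂ M))
    LinIndep⇔residual {m₂} M M₁≋A₁ = begin
      LinIndep F M                              ≈⟨ LinIndep-permute π ⟩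
      LinIndep F (M ∘ (π ⟨$⟩ʳ_))                ≈⟨ LinIndep-≋ (rows-π M) ⟩
      LinIndep F (basisRows M ++ otherRows M)   ≈⟨ LinIndep-shear (λ t i → - μ t i) ⟩
      LinIndep F (basisRows M ++ residual M)    ≈⟨ LinIndep-blockTriangular m₁ m₂ basis-indep (residual-left≡0 M M₁≋A₁) ⟩
      LinIndep F (rightBlock m₁ m₂ (residual M)) ∎
      where
      open SetoidReasoning (⇔-setoid 0ℓ)
      basis-indep : LinIndep F (leftBlock F m₁ m₂ (basisRows M))
      basis-indep = Equivalence.from (LinIndep-≋ (M₁≋A₁ ∘ σ)) (proj₂ (proj₁ A₁-rank))

  -- The left block is replaced by the representative of its class in Fin N₁, so that the basis σ
  -- and the coefficients μ used to decompose an event depend only on that class.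
  module Decomposition {l m₁ m₂ r s : ℕ} (r+s≡l : r + s ≡ l) {N₁ : ℕ} (H₁ : HasCard (RankMat F l m₁ r) (_≈R_ F) N₁) where
    representative : Fin N₁ → Mat F l m₁
    representative i = proj₁ (from H₁ i)

    module Fib (i : Fin N₁) = Fibre r+s≡l {representative i} (proj₂ (from H₁ i))

    Pieces : Set
    Pieces = Fin N₁ × (Mat F r m₂ × RankMat F s m₂ s)

    _≈P_ : Rel Pieces 0ℓ
    _≈P_ = Product.Pointwise _≡_ (Product.Pointwise _≋_ (_≈R_ F))

    class : Event F l m₁ m₂ r → Fin N₁
    class ((M , _) , M₁-rank) = to H₁ (leftBlock F m₁ m₂ M , M₁-rank)

    leftBlock≋representative : ∀ E → leftBlock F m₁ m₂ (proj₁ (proj₁ E)) ≋ representative (class E)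
    leftBlock≋representative ((M , _) , M₁-rank) = ≋-sym (from-to H₁ (leftBlock F m₁ m₂ M , M₁-rank))

    decompose : Event F l m₁ m₂ r → Pieces
    decompose E@((M , M-rank) , _) = i , Fib.basisRows i M₂ , D , LinIndep⇒HasRank {A = D} D-indep
      where
      i : Fin N₁
      i = class E
      M₂ : Mat F l m₂
      M₂ = rightBlock m₁ m₂ M
      D : Mat F s m₂
      D = Fib.residual i M₂
      D-indep : LinIndep F D
      D-indep = Equivalence.to (Fib.LinIndep⇔residual i M (leftBlock≋representative E)) (HasRank⇒LinIndep {A = M} M-rank)

    recompose : Pieces → Event F l m₁ m₂ r
    recompose (i , C , D , D-rank) =
      (M , LinIndep⇒HasRank {A = M} M-indep) , HasRank-cong (≋-sym M₁≋A₁) (proj₂ (from H₁ i))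
      where
      M : Mat F l (m₁ + m₂)
      M = representative i ∣ Fib.complete i C D
      M₁≋A₁ : leftBlock F m₁ m₂ M ≋ representative i
      M₁≋A₁ = leftBlock-∣ (representative i) (Fib.complete i C D)
      residual≋D : Fib.residual i (rightBlock m₁ m₂ M) ≋ D
      residual≋D = ≋-trans (Fib.residual-cong i (rightBlock-∣ (representative i) (Fib.complete i C D)))
                           (Fib.residual-complete i C D)
      M-indep : LinIndep F M
      M-indep = Equivalence.from (Fib.LinIndep⇔residual i M M₁≋A₁)
                  (Equivalence.from (LinIndep-≋ residual≋D) (HasRank⇒LinIndep {A = D} D-rank))

    coordinates-cong : ∀ {i i′} {A A′ : Mat F l m₂} → i ≡ i′ → A ≋ A′ →
      Fib.basisRows i A ≋ Fib.basisRows i′ A′ × Fib.residual i A ≋ Fib.residual i′ A′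
    coordinates-cong {i} refl A≋A′ = A≋A′ ∘ Fib.σ i , Fib.residual-cong i A≋A′

    decompose-cong : ∀ {E E′} → _≈E_ F E E′ → decompose E ≈P decompose E′
    decompose-cong {E} {E′} M≋M′ = class≡ , coordinates-cong class≡ (λ k j → M≋M′ k (m₁ ↑ʳ j))
      where
      class≡ : class E ≡ class E′
      class≡ = to-cong H₁ _ _ (λ k j → M≋M′ k (j ↑ˡ m₂))

    recompose-cong : ∀ {P P′} → P ≈P P′ → _≈E_ F (recompose P) (recompose P′)
    recompose-cong {i , _} (refl , C≋C′ , D≋D′) = ∣-cong (λ _ _ → refl) (Fib.complete-cong i C≋C′ D≋D′)

    recompose∘decompose : ∀ E → _≈E_ F (recompose (decompose E)) E
    recompose∘decompose E@((M , _) , _) =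
      ≋-trans (∣-cong (≋-sym (leftBlock≋representative E)) (Fib.complete-reduce (class E) (rightBlock m₁ m₂ M)))
              (leftBlock∣rightBlock {m₁ = m₁} M)

    decompose∘recompose : ∀ P → decompose (recompose P) ≈P P
    decompose∘recompose P@(i , C , D , _) =
      class≡i , ≋-trans (proj₁ coordinates≋) (Fib.basisRows-complete i C D) ,
                ≋-trans (proj₂ coordinates≋) (Fib.residual-complete i C D)
      where
      A₂ : Mat F l m₂
      A₂ = Fib.complete i C D
      M₂ : Mat F l m₂
      M₂ = rightBlock m₁ m₂ (representative i ∣ A₂)
      class≡i : class (recompose P) ≡ i
      class≡i = trans (to-cong H₁ _ (from H₁ i) (leftBlock-∣ (representative i) A₂)) (to-from H₁ i)
      coordinates≋ : Fib.basisRows (class (recompose P)) M₂ ≋ Fib.basisRows i A₂ ×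
                     Fib.residual (class (recompose P)) M₂ ≋ Fib.residual i A₂
      coordinates≋ = coordinates-cong class≡i (rightBlock-∣ (representative i) A₂)

  Event-card : ∀ {l m₁ m₂ r s : ℕ} → r + s ≡ l → ∀ {N₁ N₂ : ℕ} →
    HasCard (RankMat F l m₁ r) (_≈R_ F) N₁ → HasCard (RankMat F s m₂ s) (_≈R_ F) N₂ →
    HasCard (Event F l m₁ m₂ r) (_≈E_ F) (N₁ * ((q ^ m₂) ^ r * N₂))
  Event-card {m₂ = m₂} {r} r+s≡l {N₁} H₁ H₂ =
    HasCard-transport (λ M≋M′ M′≋M″ → ≋-trans M≋M′ M′≋M″) decompose recompose
      (λ {E} {E′} → decompose-cong {E} {E′}) (λ {P} {P′} → recompose-cong {P} {P′})
      recompose∘decompose decompose∘recompose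
      (HasCard-× (HasCard-Fin N₁) (HasCard-× (HasCard-Mat r m₂) H₂))
    where open Decomposition {m₂ = m₂} r+s≡l H₁

-- Only the count N = N₁ N₂ q^(m₂ r) of the event is needed.
lemma2 : (q : ℕ) → IsPrimePower q → (F : Field) → HasSize F q →
    (l m₁ m₂ r : ℕ) → l ≤ m₁ + m₂ → r ≤ l → r ≤ m₁ →
    (N T N₁ N₂ : ℕ) →
    HasCard (Event F l m₁ m₂ r) (_≈E_ F) N →
    HasCard (RankMat F l (m₁ + m₂) l) (_≈R_ F) T →
    HasCard (RankMat F l m₁ r) (_≈R_ F) N₁ →
    HasCard (RankMat F (l ∸ r) m₂ (l ∸ r)) (_≈R_ F) N₂ →
    N * T ≡ (N₁ * N₂ * q ^ (m₂ * r)) * T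
lemma2 q _ F size l m₁ m₂ r _ r≤l _ N T N₁ N₂ H _ H₁ H₂ = cong (_* T) (begin
  N                            ≡⟨ HasCard-unique H (FiniteField.Event-card F size (ℕ.m+[n∸m]≡n r≤l) H₁ H₂) ⟩
  N₁ * ((q ^ m₂) ^ r * N₂)     ≡⟨ cong (λ x → N₁ * (x * N₂)) (ℕ.^-*-assoc q m₂ r) ⟩
  N₁ * (q ^ (m₂ * r) * N₂)     ≡⟨ cong (N₁ *_) (ℕ.*-comm (q ^ (m₂ * r)) N₂) ⟩
  N₁ * (N₂ * q ^ (m₂ * r))     ≡⟨ ℕ.*-assoc N₁ N₂ (q ^ (m₂ * r)) ⟨
  N₁ * N₂ * q ^ (m₂ * r)       ∎)
  where open ≡-Reasoning
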